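{- For every odd integer $B\ge 3$, the numbers $(B^2+1)/2$ and $(B+1)^2/2$ are each fixed points of $S_B$.
   Context: Fix an integer $B\ge 2$. Every nonzero Gaussian integer $a+bi$ is written uniquely as $a+bi=\sum_{j=0}^n (a_j+b_ji)B^j$ with $a_j,b_j\in\mathbb{Z}$, $a_n,b_n$ not both $0$, and for each $j$: $|a_j|\le B-1$, $|b_j|\le B-1$, $\operatorname{sgn}(a)a_j\ge 0$, $\operatorname{sgn}(b)b_j\ge 0$. The Gaussian $B$-happy function $S_B:\mathbb{Z}[i]\to\mathbb{Z}[i]$ is defined by $S_B(0)=0$ and $S_B(a+bi)=\sum_{j=0}^n (a_j+b_ji)^2$. (On positive rational integers this is the sum of the squares of the base-$B$ digits.) -}

module Defs where

open import Data.Nat as ℕ using (ℕ; zero; suc; NonZero)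
open import Data.Nat.DivMod using (_/_; _%_)
open import Data.Integer as ℤ using (ℤ; +_; -[1+_]; _+_; _*_; _-_; ∣_∣)
open import Data.List using (List; []; _∷_; map)
open import Data.Product using (_×_; _,_)

ℤ[i] : Set
ℤ[i] = ℤ × ℤ

-- Base-B digits of a natural number, least significant first.
-- The fuel argument (initialised to n itself) only ensures termination;
-- since n / B < n for n > 0 and B ≥ 2, fuel n always suffices.
digitsFuel : (B : ℕ) → .{{_ : NonZero B}} → ℕ → ℕ → List ℕ
digitsFuel B zero    n       = []
digitsFuel B (suc f) zero    = []
digitsFuel B (suc f) (suc n) = (suc n % B) ∷ digitsFuel B f (suc n / B)

digitsℕ : (B : ℕ) → .{{_ : NonZero B}} → ℕ → List ℕ
digitsℕ B n = digitsFuel B n n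

-- Signed digits of an integer a: digits of |a| carrying the sign of a,
-- so that |a_j| ≤ B-1 and sgn(a) a_j ≥ 0.
signedDigits : (B : ℕ) → .{{_ : NonZero B}} → ℤ → List ℤ
signedDigits B (+ n)      = map +_ (digitsℕ B n)
signedDigits B -[1+ n ]   = map (λ d → ℤ.- (+ d)) (digitsℕ B (suc n))

-- Pair the real and imaginary digit lists, padding the shorter with zeros
-- (the expansion a+bi = Σ (a_j + b_j i) B^j).
zipPad : List ℤ → List ℤ → List ℤ[i]
zipPad []       []       = []
zipPad []       (y ∷ ys) = (+ 0 , y) ∷ zipPad [] ys
zipPad (x ∷ xs) []       = (x , + 0) ∷ zipPad xs []
zipPad (x ∷ xs) (y ∷ ys) = (x , y) ∷ zipPad xs ys

gdigits : (B : ℕ) → .{{_ : NonZero B}} → ℤ[i] → List ℤ[i]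
gdigits B (a , b) = zipPad (signedDigits B a) (signedDigits B b)

gsq : ℤ[i] → ℤ[i]
gsq (x , y) = (x * x - y * y , + 2 * (x * y))

gadd : ℤ[i] → ℤ[i] → ℤ[i]
gadd (a , b) (c , d) = (a + c , b + d)

gsum : List ℤ[i] → ℤ[i]
gsum []       = (+ 0 , + 0)
gsum (z ∷ zs) = gadd z (gsum zs)

-- The Gaussian B-happy function S_B (S_B(0) = 0 since 0 has no digits).
S : (B : ℕ) → .{{_ : NonZero B}} → ℤ[i] → ℤ[i]
S B z = gsum (map gsq (gdigits B z))

module Submission where

-- Writing B = 2k + 1, the two numbers have base-B digits (k + 1, k) and (k + 1, k + 1):
-- indeed (B² + 1)/2 = (k + 1) + k B and (B + 1)²/2 = (k + 1) + (k + 1) B.  In both cases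
-- the sum of the squares of the digits, (k + 1)² + k² resp. 2 (k + 1)², equals the number.

open import Defs
open import Data.Nat using (ℕ; NonZero; >-nonZero; _≤_; _<_; _*_; _+_; _/_; _%_; s≤s; z≤n; suc; zero)
open import Data.Nat.DivMod
  using (m<n⇒m%n≡m; m<n⇒m/n≡0; [m+kn]%n≡m%n; +-distrib-/-∣ʳ; m*n/n≡m; m≡m%n+[m/n]*n; m≥n⇒m/n>0)
open import Data.Nat.Divisibility using (divides-refl)
open import Data.Nat.Properties using (≤-trans; m≤m*n; m≤n*m; m≤n+m; m≤n⇒∃[o]m+o≡n)
import Data.Nat.Properties as ℕₚ
open import Data.Nat.Tactic.RingSolver using (solve-∀)
open import Data.Integer as ℤ using (ℤ; +_)
open import Data.Integer.Properties using (pos-+; pos-*; *-zeroʳ)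
import Data.Integer.Properties as ℤₚ
open import Data.List using (List; []; _∷_; map)
open import Data.Nat.ListAction using (sum)
open import Data.Product using (_×_; _,_; ∃-syntax)
open import Relation.Binary.PropositionalEquality
open ≡-Reasoning

module _ (B : ℕ) .{{_ : NonZero B}} where

  digitsFuel-zero : ∀ f → digitsFuel B f 0 ≡ []
  digitsFuel-zero zero    = refl
  digitsFuel-zero (suc f) = refl

  digitsFuel-suc : ∀ f {n} → 0 < n → digitsFuel B (suc f) n ≡ n % B ∷ digitsFuel B f (n / B)
  digitsFuel-suc f {suc n} _ = refl

  module _ {d q : ℕ} (d<B : d < B) (0<q : 0 < q) (q<B : q < B) where

    [d+q*B]%B≡d : (d + q * B) % B ≡ d
    [d+q*B]%B≡d = trans ([m+kn]%n≡m%n d q B) (m<n⇒m%n≡m d<B)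

    [d+q*B]/B≡q : (d + q * B) / B ≡ q
    [d+q*B]/B≡q = trans (+-distrib-/-∣ʳ d (divides-refl q))
                        (cong₂ _+_ (m<n⇒m/n≡0 d<B) (m*n/n≡m q B))

    2≤d+q*B : 2 ≤ d + q * B
    2≤d+q*B = ≤-trans (≤-trans (s≤s 0<q) q<B)
                       (≤-trans (m≤n*m B q {{>-nonZero 0<q}}) (m≤n+m (q * B) d))

    digitsFuel-two-digits : ∀ f → digitsFuel B (2 + f) (d + q * B) ≡ d ∷ q ∷ []
    digitsFuel-two-digits f = begin
      digitsFuel B (2 + f) (d + q * B)
        ≡⟨ digitsFuel-suc (suc f) (≤-trans (s≤s z≤n) 2≤d+q*B) ⟩
      (d + q * B) % B ∷ digitsFuel B (suc f) ((d + q * B) / B)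
        ≡⟨ cong₂ (λ r s → r ∷ digitsFuel B (suc f) s) [d+q*B]%B≡d [d+q*B]/B≡q ⟩
      d ∷ digitsFuel B (suc f) q
        ≡⟨ cong (d ∷_) (digitsFuel-suc f 0<q) ⟩
      d ∷ q % B ∷ digitsFuel B f (q / B)
        ≡⟨ cong₂ (λ r s → d ∷ r ∷ digitsFuel B f s) (m<n⇒m%n≡m q<B) (m<n⇒m/n≡0 q<B) ⟩
      d ∷ q ∷ digitsFuel B f 0
        ≡⟨ cong (λ ds → d ∷ q ∷ ds) (digitsFuel-zero f) ⟩
      d ∷ q ∷ [] ∎

    digitsℕ-two-digits : digitsℕ B (d + q * B) ≡ d ∷ q ∷ []
    digitsℕ-two-digits with f , 2+f≡n ← m≤n⇒∃[o]m+o≡n 2≤d+q*B =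
      subst (λ fuel → digitsFuel B fuel (d + q * B) ≡ d ∷ q ∷ []) 2+f≡n (digitsFuel-two-digits f)

sumOfSquares : List ℕ → ℕ
sumOfSquares ds = sum (map (λ d → d * d) ds)

gsq-real : ∀ (x : ℤ) → gsq (x , + 0) ≡ (x ℤ.* x , + 0)
gsq-real x = cong₂ _,_ (ℤₚ.+-identityʳ (x ℤ.* x)) (cong (+ 2 ℤ.*_) (*-zeroʳ x))

gsum-real-digits : ∀ ds → gsum (map gsq (zipPad (map +_ ds) [])) ≡ (+ sumOfSquares ds , + 0)
gsum-real-digits []       = refl
gsum-real-digits (d ∷ ds) = begin
  gadd (gsq (+ d , + 0)) (gsum (map gsq (zipPad (map +_ ds) [])))
    ≡⟨ cong₂ gadd (gsq-real (+ d)) (gsum-real-digits ds) ⟩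
  (+ d ℤ.* + d ℤ.+ + sumOfSquares ds , + 0)
    ≡⟨ cong (λ x → x ℤ.+ + sumOfSquares ds , + 0) (sym (pos-* d d)) ⟩
  (+ (d * d) ℤ.+ + sumOfSquares ds , + 0)
    ≡⟨ cong (_, + 0) (sym (pos-+ (d * d) (sumOfSquares ds))) ⟩
  (+ sumOfSquares (d ∷ ds) , + 0) ∎

-- The imaginary part 0 has no digits, so only the real digits contribute.
S-natural : ∀ B .{{_ : NonZero B}} n → S B (+ n , + 0) ≡ (+ sumOfSquares (digitsℕ B n) , + 0)
S-natural B n = gsum-real-digits (digitsℕ B n)

S-fixed-two-digits : ∀ B .{{_ : NonZero B}} {N d q} → d < B → 0 < q → q < B →
                     N ≡ d + q * B → d * d + q * q ≡ N → S B (+ N , + 0) ≡ (+ N , + 0)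
S-fixed-two-digits B {N} {d} {q} d<B 0<q q<B refl squares≡N = begin
  S B (+ N , + 0)
    ≡⟨ S-natural B N ⟩
  (+ sumOfSquares (digitsℕ B N) , + 0)
    ≡⟨ cong (λ ds → + sumOfSquares ds , + 0) (digitsℕ-two-digits B d<B 0<q q<B) ⟩
  (+ (d * d + (q * q + 0)) , + 0)
    ≡⟨ cong (λ s → + (d * d + s) , + 0) (ℕₚ.+-identityʳ (q * q)) ⟩
  (+ (d * d + q * q) , + 0)
    ≡⟨ cong (λ s → + s , + 0) squares≡N ⟩
  (+ N , + 0) ∎

n≡m*2⇒n/2≡m : ∀ {n} m → n ≡ m * 2 → n / 2 ≡ m
n≡m*2⇒n/2≡m m refl = m*n/n≡m m 2

odd²+1≡double : ∀ k → suc (k * 2) * suc (k * 2) + 1 ≡ (suc k + k * suc (k * 2)) * 2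
odd²+1≡double = solve-∀

[1+k]²+k²≡1+k+k*odd : ∀ k → suc k * suc k + k * k ≡ suc k + k * suc (k * 2)
[1+k]²+k²≡1+k+k*odd = solve-∀

[odd+1]²≡double : ∀ k → (suc (k * 2) + 1) * (suc (k * 2) + 1) ≡ (suc k + suc k * suc (k * 2)) * 2
[odd+1]²≡double = solve-∀

[1+k]²+[1+k]²≡1+k+[1+k]*odd : ∀ k → suc k * suc k + suc k * suc k ≡ suc k + suc k * suc (k * 2)
[1+k]²+[1+k]²≡1+k+[1+k]*odd = solve-∀

k<1+k*2 : ∀ k → k < suc (k * 2)
k<1+k*2 k = s≤s (m≤m*n k 2)

1+k<1+k*2 : ∀ {k} → 0 < k → suc k < suc (k * 2)
1+k<1+k*2 {suc m} _ = s≤s (s≤s (s≤s (m≤m*n m 2)))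

fixed-points-odd : ∀ B .{{_ : NonZero B}} {k} → 0 < k → B ≡ suc (k * 2) →
    (S B (+ ((B * B + 1) / 2) , + 0) ≡ (+ ((B * B + 1) / 2) , + 0))
    × (S B (+ ((B + 1) * (B + 1) / 2) , + 0) ≡ (+ ((B + 1) * (B + 1) / 2) , + 0))
fixed-points-odd B {k} 0<k refl =
  S-fixed-two-digits B (1+k<1+k*2 0<k) 0<k (k<1+k*2 k)
    half-B²+1 (trans ([1+k]²+k²≡1+k+k*odd k) (sym half-B²+1)) ,
  S-fixed-two-digits B (1+k<1+k*2 0<k) (s≤s z≤n) (1+k<1+k*2 0<k)
    half-[B+1]² (trans ([1+k]²+[1+k]²≡1+k+[1+k]*odd k) (sym half-[B+1]²))
  where
  half-B²+1 : (B * B + 1) / 2 ≡ suc k + k * B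
  half-B²+1 = n≡m*2⇒n/2≡m (suc k + k * B) (odd²+1≡double k)
  half-[B+1]² : (B + 1) * (B + 1) / 2 ≡ suc k + suc k * B
  half-[B+1]² = n≡m*2⇒n/2≡m (suc k + suc k * B) ([odd+1]²≡double k)

odd⇒≡1+k*2 : ∀ B → 3 ≤ B → B % 2 ≡ 1 → ∃[ k ] 0 < k × B ≡ suc (k * 2)
odd⇒≡1+k*2 B 3≤B B%2≡1 = B / 2 , m≥n⇒m/n>0 (≤-trans (s≤s (s≤s z≤n)) 3≤B) ,
  trans (m≡m%n+[m/n]*n B 2) (cong (_+ B / 2 * 2) B%2≡1)

theorem7 : (B : ℕ) → .{{_ : NonZero B}} → 3 ≤ B → B % 2 ≡ 1 →
    (S B (+ ((B * B + 1) / 2) , + 0) ≡ (+ ((B * B + 1) / 2) , + 0))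
    × (S B (+ (((B + 1) * (B + 1)) / 2) , + 0) ≡ (+ (((B + 1) * (B + 1)) / 2) , + 0))
theorem7 B 3≤B B%2≡1 =
  let k , 0<k , B≡1+k*2 = odd⇒≡1+k*2 B 3≤B B%2≡1 in fixed-points-odd B 0<k B≡1+k*2
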